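{- Let $S$ be an inverse monoid. Define $S_0=S$ and $S_{n+1}=\overline{S_n}$, the complementary closure of $S_n$ (computed inside $\mathbb{Z}[S]$), and let $\overline{S}_\omega=\bigcup_{n\ge 0}S_n$. For $u\in\overline{S}_\omega$ put $[u]=1-uu^*$. Then $\overline{S}_\omega$, with the linearly extended star and the operation $[\cdot]$, is a bar inverse monoid.
   Context: An inverse monoid is a monoid with a unary operation $u\mapsto u^*$ such that $(uv)^*=v^*u^*$, $(u^*)^*=u$, $uu^*u=u$, $uu^*vv^*=vv^*uu^*$. $\mathbb{Z}[S]$ denotes the algebra of finite $\mathbb{Z}$-linear combinations of elements of $S$ (the zero of $S$, if any, identified with $0$), with star extended linearly: $(\sum n_is_i)^*=\sum n_is_i^*$. For an inverse monoid $T\subseteq\mathbb{Z}[S]$ (closed under the star), its complementary closure $\overline{T}$ is the submonoid of $\mathbb{Z}[S]$ generated by $T\cup\{1-uu^*:u\in T\}$; it is again an inverse monoid. A bar inverse monoid is an inverse monoid with a zero element $0$ and a unary operation $[\cdot]$ satisfying $[1]=0$, $[0]=1$ and $u[v]=[uv]u$ for all $u,v$. -}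

module Defs where

open import Data.Integer using (ℤ; 0ℤ; 1ℤ; -_) renaming (_+_ to _+ℤ_; _*_ to _*ℤ_)
open import Data.Nat using (ℕ; zero; suc)
open import Data.List using (List; []; _∷_; _++_; map; concatMap)
open import Data.Product using (_×_; _,_; Σ; ∃; ∃-syntax)
open import Relation.Binary.PropositionalEquality using (_≡_)
open import Relation.Binary.Structures using (IsEquivalence)

record InverseMonoid : Set₁ where
  infixl 7 _·_
  field
    Carrier  : Set
    _·_      : Carrier → Carrier → Carrier
    ε        : Carrier
    _⋆       : Carrier → Carrier
    assoc    : ∀ x y z → (x · y) · z ≡ x · (y · z)
    identityˡ : ∀ x → ε · x ≡ x
    identityʳ : ∀ x → x · ε ≡ x
    ⋆-anti   : ∀ u v → (u · v) ⋆ ≡ (v ⋆) · (u ⋆)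
    ⋆-invol  : ∀ u → (u ⋆) ⋆ ≡ u
    inverse  : ∀ u → u · (u ⋆) · u ≡ u
    idem-comm : ∀ u v → u · (u ⋆) · (v · (v ⋆)) ≡ v · (v ⋆) · (u · (u ⋆))

  IsZero : Carrier → Set
  IsZero z = ∀ x → (z · x ≡ z) × (x · z ≡ z)

-- The algebra ℤ[S]: finite formal ℤ-linear combinations of elements
-- of S, represented by lists of (coefficient , element), modulo the
-- equivalence _≋_ generated by reordering, merging equal elements,
-- dropping zero coefficients, and identifying the zero of S (if any)
-- with 0.

module ZAlg (S : InverseMonoid) where
  open InverseMonoid S renaming (Carrier to A)

  Lin : Set
  Lin = List (ℤ × A)

  infix 4 _≋_
  data _≋_ : Lin → Lin → Set where
    ≋-refl  : ∀ {x} → x ≋ x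
    ≋-sym   : ∀ {x y} → x ≋ y → y ≋ x
    ≋-trans : ∀ {x y z} → x ≋ y → y ≋ z → x ≋ z
    ≋-cons  : ∀ {x y} t → x ≋ y → (t ∷ x) ≋ (t ∷ y)
    ≋-swap  : ∀ p q x → (p ∷ q ∷ x) ≋ (q ∷ p ∷ x)
    ≋-merge : ∀ a b s x → ((a , s) ∷ (b , s) ∷ x) ≋ ((a +ℤ b , s) ∷ x)
    ≋-zeroc : ∀ s x → ((0ℤ , s) ∷ x) ≋ x
    ≋-zeroS : ∀ a z x → IsZero z → ((a , z) ∷ x) ≋ x

  infixl 6 _⊕_ _⊖_
  infixl 7 _⊗_

  𝟘 : Lin
  𝟘 = []

  𝟙 : Lin
  𝟙 = (1ℤ , ε) ∷ []

  _⊕_ : Lin → Lin → Lin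
  _⊕_ = _++_

  neg : Lin → Lin
  neg = map (λ { (a , s) → (- a , s) })

  _⊖_ : Lin → Lin → Lin
  x ⊖ y = x ⊕ neg y

  _⊗_ : Lin → Lin → Lin
  x ⊗ y = concatMap (λ { (a , s) → map (λ { (b , t) → (a *ℤ b , s · t) }) y }) x

  star : Lin → Lin
  star = map (λ { (a , s) → (a , s ⋆) })

  bar : Lin → Lin
  bar u = 𝟙 ⊖ u ⊗ star u

  ι : A → Lin
  ι s = (1ℤ , s) ∷ []

  data Closure (T : Lin → Set) : Lin → Set where
    base : ∀ {u} → T u → Closure T u
    comp : ∀ {u} → T u → Closure T (𝟙 ⊖ u ⊗ star u)
    one  : Closure T 𝟙
    mul  : ∀ {u v} → Closure T u → Closure T v → Closure T (u ⊗ v)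
    resp : ∀ {u v} → u ≋ v → Closure T u → Closure T v

  Level : ℕ → Lin → Set
  Level zero    u = ∃[ s ] (u ≋ ι s)
  Level (suc n) u = Closure (Level n) u

  Ω : Lin → Set
  Ω u = ∃[ n ] Level n u

record IsBarInverseSubmonoid {A : Set} (_≈_ : A → A → Set)
    (_∙_ : A → A → A) (e : A) (_⋆ : A → A) (z : A) ([_] : A → A)
    (P : A → Set) : Set where
  field
    ≈-isEquivalence : IsEquivalence _≈_
    P-resp   : ∀ {u v} → u ≈ v → P u → P v
    e∈       : P e
    z∈       : P z
    ∙-closed : ∀ {u v} → P u → P v → P (u ∙ v)
    ⋆-closed : ∀ {u} → P u → P (u ⋆)
    []-closed : ∀ {u} → P u → P [ u ]
    ∙-cong   : ∀ {u u′ v v′} → P u → P u′ → P v → P v′ →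
               u ≈ u′ → v ≈ v′ → (u ∙ v) ≈ (u′ ∙ v′)
    ⋆-cong   : ∀ {u u′} → P u → P u′ → u ≈ u′ → (u ⋆) ≈ (u′ ⋆)
    []-cong  : ∀ {u u′} → P u → P u′ → u ≈ u′ → [ u ] ≈ [ u′ ]
    assoc    : ∀ {u v w} → P u → P v → P w → ((u ∙ v) ∙ w) ≈ (u ∙ (v ∙ w))
    identityˡ : ∀ {u} → P u → (e ∙ u) ≈ u
    identityʳ : ∀ {u} → P u → (u ∙ e) ≈ u
    ⋆-anti   : ∀ {u v} → P u → P v → ((u ∙ v) ⋆) ≈ ((v ⋆) ∙ (u ⋆))
    ⋆-invol  : ∀ {u} → P u → ((u ⋆) ⋆) ≈ u
    inverse  : ∀ {u} → P u → ((u ∙ (u ⋆)) ∙ u) ≈ u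
    idem-comm : ∀ {u v} → P u → P v →
                ((u ∙ (u ⋆)) ∙ (v ∙ (v ⋆))) ≈ ((v ∙ (v ⋆)) ∙ (u ∙ (u ⋆)))
    zeroˡ    : ∀ {u} → P u → (z ∙ u) ≈ z
    zeroʳ    : ∀ {u} → P u → (u ∙ z) ≈ z
    bar-one  : [ e ] ≈ z
    bar-zero : [ z ] ≈ e
    bar-comm : ∀ {u v} → P u → P v → (u ∙ [ v ]) ≈ ([ u ∙ v ] ∙ u)

-- Every element u of Ω has a normal form u ≈ p s with s ∈ S and p in the
-- algebra of idempotents generated by the elements s s* under products and
-- complements 1 - p. These generators commute (idempotents of an inverse
-- monoid do), so that algebra consists of commuting self-adjoint
-- idempotents and is stable under conjugation p ↦ s p s*. Since s p = (s p s*) s,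
-- normal forms are closed under products and star, and u u* = p (s s*) is
-- again such an idempotent; this gives u u* u = u and commutation of the
-- u u*. The bar law u [v] = [u v] u reduces to u v v* u* u = u v v*, which
-- follows from the commutation of v v* with u* u together with u u* u = u.
module Submission where

open import Defs
open import Data.Integer using (ℤ; 0ℤ; 1ℤ; -_) renaming (_+_ to _+ℤ_; _*_ to _*ℤ_)
import Data.Integer.Properties as ℤ
open import Data.Nat using (zero; suc; _≤′_; ≤′-refl; ≤′-step; _⊔_)
open import Data.Nat.Properties using (≤⇒≤′; m≤m⊔n; m≤n⊔m)
open import Data.List using ([]; _∷_; _++_)
open import Data.List.Properties using (++-assoc; ++-identityʳ)
open import Data.Product using (_×_; _,_; ∃₂; proj₁; proj₂)
open import Relation.Binary.PropositionalEquality using (_≡_; refl; sym; trans; cong; cong₂)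
open import Relation.Binary.Structures using (IsEquivalence)
open import Relation.Binary.Bundles using (Setoid)

module InverseMonoidProperties (S : InverseMonoid) where
  open InverseMonoid S

  ε⋆ : ε ⋆ ≡ ε
  ε⋆ = trans (sym (identityʳ (ε ⋆)))
       (trans (cong (ε ⋆ ·_) (sym (⋆-invol ε)))
       (trans (sym (⋆-anti (ε ⋆) ε)) (trans (cong _⋆ (identityʳ (ε ⋆))) (⋆-invol ε))))

  zeroˡ : ∀ {z} → IsZero z → ∀ s → z · s ≡ z
  zeroˡ isZero s = proj₁ (isZero s)

  zeroʳ : ∀ {z} → IsZero z → ∀ s → s · z ≡ z
  zeroʳ isZero s = proj₂ (isZero s)

  zero⋆ : ∀ {z} → IsZero z → z ⋆ ≡ z
  zero⋆ {z} isZero = trans (sym (inverse (z ⋆)))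
    (trans (cong (λ w → z ⋆ · w · z ⋆) (⋆-invol z))
    (trans (cong (_· z ⋆) (zeroʳ isZero (z ⋆))) (zeroˡ isZero (z ⋆))))

  inverse′ : ∀ s → s · (s ⋆ · s) ≡ s
  inverse′ s = trans (sym (assoc s (s ⋆) s)) (inverse s)

  ss⋆-idem : ∀ s → s · s ⋆ · (s · s ⋆) ≡ s · s ⋆
  ss⋆-idem s = trans (sym (assoc (s · s ⋆) s (s ⋆))) (cong (_· s ⋆) (inverse s))

  ss⋆-⋆ : ∀ s → (s · s ⋆) ⋆ ≡ s · s ⋆
  ss⋆-⋆ s = trans (⋆-anti s (s ⋆)) (cong (_· s ⋆) (⋆-invol s))

  ss⋆-conj : ∀ s t → s · t · (s · t) ⋆ ≡ s · (t · t ⋆) · s ⋆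
  ss⋆-conj s t = trans (cong (s · t ·_) (⋆-anti s t))
    (trans (sym (assoc (s · t) (t ⋆) (s ⋆))) (cong (_· s ⋆) (assoc s t (t ⋆))))

module LinearCombinations (S : InverseMonoid) where
  open InverseMonoid S renaming (Carrier to A)
  open InverseMonoidProperties S
  open ZAlg S

  ≋-isEquivalence : IsEquivalence _≋_
  ≋-isEquivalence = record { refl = ≋-refl ; sym = ≋-sym ; trans = ≋-trans }

  ≋-setoid : Setoid _ _
  ≋-setoid = record { isEquivalence = ≋-isEquivalence }

  open import Relation.Binary.Reasoning.Setoid ≋-setoid public

  ≡⇒≋ : ∀ {x y} → x ≡ y → x ≋ y
  ≡⇒≋ refl = ≋-refl

  ≋-coeff : ∀ {a b} s x → a ≡ b → ((a , s) ∷ x) ≋ ((b , s) ∷ x)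
  ≋-coeff s x refl = ≋-refl

  ++-congˡ : ∀ {x x′} y → x ≋ x′ → x ++ y ≋ x′ ++ y
  ++-congˡ y ≋-refl = ≋-refl
  ++-congˡ y (≋-sym p) = ≋-sym (++-congˡ y p)
  ++-congˡ y (≋-trans p q) = ≋-trans (++-congˡ y p) (++-congˡ y q)
  ++-congˡ y (≋-cons t p) = ≋-cons t (++-congˡ y p)
  ++-congˡ y (≋-swap p q x) = ≋-swap p q (x ++ y)
  ++-congˡ y (≋-merge a b s x) = ≋-merge a b s (x ++ y)
  ++-congˡ y (≋-zeroc s x) = ≋-zeroc s (x ++ y)
  ++-congˡ y (≋-zeroS a z x isZero) = ≋-zeroS a z (x ++ y) isZero

  ++-congʳ : ∀ x {y y′} → y ≋ y′ → x ++ y ≋ x ++ y′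
  ++-congʳ [] p = p
  ++-congʳ (t ∷ x) p = ≋-cons t (++-congʳ x p)

  ++-cong : ∀ {x x′ y y′} → x ≋ x′ → y ≋ y′ → x ++ y ≋ x′ ++ y′
  ++-cong {x′ = x′} {y = y} p q = ≋-trans (++-congˡ y p) (++-congʳ x′ q)

  ++-∷ : ∀ x t y → x ++ (t ∷ y) ≋ t ∷ (x ++ y)
  ++-∷ [] t y = ≋-refl
  ++-∷ (u ∷ x) t y = ≋-trans (≋-cons u (++-∷ x t y)) (≋-swap u t (x ++ y))

  ++-comm : ∀ x y → x ++ y ≋ y ++ x
  ++-comm [] y = ≡⇒≋ (sym (++-identityʳ y))
  ++-comm (t ∷ x) y = ≋-trans (≋-cons t (++-comm x y)) (≋-sym (++-∷ y t x))

  ++-swap : ∀ x y z → x ++ (y ++ z) ≋ y ++ (x ++ z)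
  ++-swap x y z = begin
    x ++ (y ++ z)  ≡⟨ ++-assoc x y z ⟨
    (x ++ y) ++ z  ≈⟨ ++-congˡ z (++-comm x y) ⟩
    (y ++ x) ++ z  ≡⟨ ++-assoc y x z ⟩
    y ++ (x ++ z)  ∎

  ++-interchange : ∀ w x y z → (w ++ x) ++ (y ++ z) ≋ (w ++ y) ++ (x ++ z)
  ++-interchange w x y z = begin
    (w ++ x) ++ (y ++ z)  ≡⟨ ++-assoc w x (y ++ z) ⟩
    w ++ (x ++ (y ++ z))  ≈⟨ ++-congʳ w (++-swap x y z) ⟩
    w ++ (y ++ (x ++ z))  ≡⟨ ++-assoc w y (x ++ z) ⟨
    (w ++ y) ++ (x ++ z)  ∎

  neg-++ : ∀ x y → neg (x ++ y) ≡ neg x ++ neg y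
  neg-++ [] y = refl
  neg-++ ((a , s) ∷ x) y = cong ((- a , s) ∷_) (neg-++ x y)

  neg-cong : ∀ {x y} → x ≋ y → neg x ≋ neg y
  neg-cong ≋-refl = ≋-refl
  neg-cong (≋-sym p) = ≋-sym (neg-cong p)
  neg-cong (≋-trans p q) = ≋-trans (neg-cong p) (neg-cong q)
  neg-cong (≋-cons (a , s) p) = ≋-cons (- a , s) (neg-cong p)
  neg-cong (≋-swap (a , s) (b , t) x) = ≋-swap (- a , s) (- b , t) (neg x)
  neg-cong (≋-merge a b s x) =
    ≋-trans (≋-merge (- a) (- b) s (neg x)) (≋-coeff s (neg x) (sym (ℤ.neg-distrib-+ a b)))
  neg-cong (≋-zeroc s x) = ≋-zeroc s (neg x)
  neg-cong (≋-zeroS a z x isZero) = ≋-zeroS (- a) z (neg x) isZero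

  ⊖-congʳ : ∀ x {y y′} → y ≋ y′ → x ⊖ y ≋ x ⊖ y′
  ⊖-congʳ x q = ++-congʳ x (neg-cong q)

  ⊖-self : ∀ x → x ⊖ x ≋ 𝟘
  ⊖-self [] = ≋-refl
  ⊖-self ((a , s) ∷ x) =
    ≋-trans (≋-cons (a , s) (++-∷ x (- a , s) (neg x)))
    (≋-trans (≋-merge a (- a) s (x ++ neg x))
    (≋-trans (≋-coeff s _ (ℤ.+-inverseʳ a))
    (≋-trans (≋-zeroc s _) (⊖-self x))))

  scale : ℤ → A → Lin → Lin
  scale a s [] = []
  scale a s ((b , t) ∷ y) = (a *ℤ b , s · t) ∷ scale a s y

  ⊗-singleton : ∀ a s y → ((a , s) ∷ []) ⊗ y ≡ scale a s y
  ⊗-singleton a s [] = refl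
  ⊗-singleton a s ((b , t) ∷ y) = cong ((a *ℤ b , s · t) ∷_) (⊗-singleton a s y)

  ⊗-∷ : ∀ a s x y → ((a , s) ∷ x) ⊗ y ≡ scale a s y ++ x ⊗ y
  ⊗-∷ a s x y = cong (_++ x ⊗ y) (trans (sym (++-identityʳ _)) (⊗-singleton a s y))

  scale-++ : ∀ a s x y → scale a s (x ++ y) ≡ scale a s x ++ scale a s y
  scale-++ a s [] y = refl
  scale-++ a s ((b , t) ∷ x) y = cong ((a *ℤ b , s · t) ∷_) (scale-++ a s x y)

  scale-cong : ∀ a s {y y′} → y ≋ y′ → scale a s y ≋ scale a s y′
  scale-cong a s ≋-refl = ≋-refl
  scale-cong a s (≋-sym p) = ≋-sym (scale-cong a s p)
  scale-cong a s (≋-trans p q) = ≋-trans (scale-cong a s p) (scale-cong a s q)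
  scale-cong a s (≋-cons (b , t) p) = ≋-cons (a *ℤ b , s · t) (scale-cong a s p)
  scale-cong a s (≋-swap (b , t) (c , u) x) = ≋-swap _ _ (scale a s x)
  scale-cong a s (≋-merge b c t x) =
    ≋-trans (≋-merge (a *ℤ b) (a *ℤ c) (s · t) (scale a s x))
            (≋-coeff (s · t) _ (sym (ℤ.*-distribˡ-+ a b c)))
  scale-cong a s (≋-zeroc t x) = ≋-trans (≋-coeff (s · t) _ (ℤ.*-zeroʳ a)) (≋-zeroc _ _)
  scale-cong a s (≋-zeroS b z x isZero) rewrite zeroʳ isZero s = ≋-zeroS _ z _ isZero

  scale-+ : ∀ a b s y → scale a s y ++ scale b s y ≋ scale (a +ℤ b) s y
  scale-+ a b s [] = ≋-refl
  scale-+ a b s ((c , t) ∷ y) =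
    ≋-trans (≋-cons _ (++-∷ (scale a s y) _ (scale b s y)))
    (≋-trans (≋-merge _ _ _ _)
    (≋-trans (≋-coeff _ _ (sym (ℤ.*-distribʳ-+ c a b))) (≋-cons _ (scale-+ a b s y))))

  scale-0 : ∀ s y → scale 0ℤ s y ≋ 𝟘
  scale-0 s [] = ≋-refl
  scale-0 s ((c , t) ∷ y) = ≋-trans (≋-zeroc _ _) (scale-0 s y)

  scale-zero : ∀ a {z} → IsZero z → ∀ y → scale a z y ≋ 𝟘
  scale-zero a isZero [] = ≋-refl
  scale-zero a {z} isZero ((c , t) ∷ y) rewrite zeroˡ isZero t =
    ≋-trans (≋-zeroS _ z _ isZero) (scale-zero a isZero y)

  scale-neg : ∀ a s y → scale a s (neg y) ≡ neg (scale a s y)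
  scale-neg a s [] = refl
  scale-neg a s ((b , t) ∷ y) =
    cong₂ (λ c w → (c , s · t) ∷ w) (sym (ℤ.neg-distribʳ-* a b)) (scale-neg a s y)

  neg-scale : ∀ a s y → neg (scale a s y) ≡ scale (- a) s y
  neg-scale a s [] = refl
  neg-scale a s ((b , t) ∷ y) =
    cong₂ (λ c w → (c , s · t) ∷ w) (ℤ.neg-distribˡ-* a b) (neg-scale a s y)

  scale-scale : ∀ a s b t z → scale (a *ℤ b) (s · t) z ≡ scale a s (scale b t z)
  scale-scale a s b t [] = refl
  scale-scale a s b t ((c , u) ∷ z) rewrite ℤ.*-assoc a b c | assoc s t u =
    cong (_ ∷_) (scale-scale a s b t z)

  scale-identity : ∀ x → scale 1ℤ ε x ≡ x
  scale-identity [] = refl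
  scale-identity ((b , t) ∷ x) rewrite ℤ.*-identityˡ b | identityˡ t | scale-identity x = refl

  ⊗-congʳ : ∀ x {y y′} → y ≋ y′ → x ⊗ y ≋ x ⊗ y′
  ⊗-congʳ [] p = ≋-refl
  ⊗-congʳ ((a , s) ∷ x) {y} {y′} p rewrite ⊗-∷ a s x y | ⊗-∷ a s x y′ =
    ++-cong (scale-cong a s p) (⊗-congʳ x p)

  ⊗-congˡ : ∀ {x x′} y → x ≋ x′ → x ⊗ y ≋ x′ ⊗ y
  ⊗-congˡ y ≋-refl = ≋-refl
  ⊗-congˡ y (≋-sym p) = ≋-sym (⊗-congˡ y p)
  ⊗-congˡ y (≋-trans p q) = ≋-trans (⊗-congˡ y p) (⊗-congˡ y q)
  ⊗-congˡ y (≋-cons {x} {x′} (a , s) p) rewrite ⊗-∷ a s x y | ⊗-∷ a s x′ y =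
    ++-congʳ (scale a s y) (⊗-congˡ y p)
  ⊗-congˡ y (≋-swap (a , s) (b , t) x)
    rewrite ⊗-∷ a s ((b , t) ∷ x) y | ⊗-∷ b t x y | ⊗-∷ b t ((a , s) ∷ x) y | ⊗-∷ a s x y =
    ++-swap (scale a s y) (scale b t y) (x ⊗ y)
  ⊗-congˡ y (≋-merge a b s x)
    rewrite ⊗-∷ a s ((b , s) ∷ x) y | ⊗-∷ b s x y | ⊗-∷ (a +ℤ b) s x y =
    ≋-trans (≡⇒≋ (sym (++-assoc (scale a s y) (scale b s y) (x ⊗ y))))
            (++-congˡ (x ⊗ y) (scale-+ a b s y))
  ⊗-congˡ y (≋-zeroc s x) rewrite ⊗-∷ 0ℤ s x y = ++-congˡ (x ⊗ y) (scale-0 s y)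
  ⊗-congˡ y (≋-zeroS a z x isZero) rewrite ⊗-∷ a z x y =
    ++-congˡ (x ⊗ y) (scale-zero a isZero y)

  ⊗-cong : ∀ {x x′ y y′} → x ≋ x′ → y ≋ y′ → x ⊗ y ≋ x′ ⊗ y′
  ⊗-cong {x′ = x′} {y = y} p q = ≋-trans (⊗-congˡ y p) (⊗-congʳ x′ q)

  ⊗-distribʳ-⊕ : ∀ x x′ y → (x ⊕ x′) ⊗ y ≡ x ⊗ y ⊕ x′ ⊗ y
  ⊗-distribʳ-⊕ [] x′ y = refl
  ⊗-distribʳ-⊕ ((a , s) ∷ x) x′ y
    rewrite ⊗-∷ a s (x ++ x′) y | ⊗-∷ a s x y | ⊗-distribʳ-⊕ x x′ y =
    sym (++-assoc (scale a s y) (x ⊗ y) (x′ ⊗ y))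

  ⊗-distribˡ-⊕ : ∀ x y y′ → x ⊗ (y ⊕ y′) ≋ x ⊗ y ⊕ x ⊗ y′
  ⊗-distribˡ-⊕ [] y y′ = ≋-refl
  ⊗-distribˡ-⊕ ((a , s) ∷ x) y y′
    rewrite ⊗-∷ a s x (y ++ y′) | ⊗-∷ a s x y | ⊗-∷ a s x y′ | scale-++ a s y y′ =
    ≋-trans (++-congʳ (scale a s y ++ scale a s y′) (⊗-distribˡ-⊕ x y y′))
            (++-interchange (scale a s y) (scale a s y′) (x ⊗ y) (x ⊗ y′))

  ⊗-neg : ∀ x y → x ⊗ neg y ≡ neg (x ⊗ y)
  ⊗-neg [] y = refl
  ⊗-neg ((a , s) ∷ x) y rewrite ⊗-∷ a s x (neg y) | ⊗-∷ a s x y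
    | neg-++ (scale a s y) (x ⊗ y) | scale-neg a s y | ⊗-neg x y = refl

  neg-⊗ : ∀ x y → neg x ⊗ y ≡ neg (x ⊗ y)
  neg-⊗ [] y = refl
  neg-⊗ ((a , s) ∷ x) y rewrite ⊗-∷ (- a) s (neg x) y | ⊗-∷ a s x y
    | neg-++ (scale a s y) (x ⊗ y) | neg-scale a s y | neg-⊗ x y = refl

  scale-⊗ : ∀ a s y z → scale a s y ⊗ z ≡ scale a s (y ⊗ z)
  scale-⊗ a s [] z = refl
  scale-⊗ a s ((b , t) ∷ y) z rewrite ⊗-∷ (a *ℤ b) (s · t) (scale a s y) z | ⊗-∷ b t y z
    | scale-++ a s (scale b t z) (y ⊗ z) | scale-scale a s b t z | scale-⊗ a s y z = refl

  ⊗-assoc-≡ : ∀ x y z → (x ⊗ y) ⊗ z ≡ x ⊗ (y ⊗ z)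
  ⊗-assoc-≡ [] y z = refl
  ⊗-assoc-≡ ((a , s) ∷ x) y z rewrite ⊗-∷ a s x y | ⊗-∷ a s x (y ⊗ z)
    | ⊗-distribʳ-⊕ (scale a s y) (x ⊗ y) z | scale-⊗ a s y z | ⊗-assoc-≡ x y z = refl

  ⊗-assoc : ∀ x y z → (x ⊗ y) ⊗ z ≋ x ⊗ (y ⊗ z)
  ⊗-assoc x y z = ≡⇒≋ (⊗-assoc-≡ x y z)

  ⊗-identityˡ : ∀ x → 𝟙 ⊗ x ≡ x
  ⊗-identityˡ x rewrite ⊗-∷ 1ℤ ε [] x | scale-identity x = ++-identityʳ x

  ⊗-identityʳ : ∀ x → x ⊗ 𝟙 ≡ x
  ⊗-identityʳ [] = refl
  ⊗-identityʳ ((a , s) ∷ x) rewrite ⊗-∷ a s x 𝟙 | ℤ.*-identityʳ a | identityʳ s =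
    cong ((a , s) ∷_) (⊗-identityʳ x)

  ⊗-zeroʳ : ∀ x → x ⊗ 𝟘 ≡ 𝟘
  ⊗-zeroʳ [] = refl
  ⊗-zeroʳ ((a , s) ∷ x) rewrite ⊗-∷ a s x [] = ⊗-zeroʳ x

  compl-⊗ : ∀ p q → (𝟙 ⊖ p) ⊗ q ≋ q ⊖ p ⊗ q
  compl-⊗ p q = ≡⇒≋ (trans (⊗-distribʳ-⊕ 𝟙 (neg p) q) (cong₂ _++_ (⊗-identityˡ q) (neg-⊗ p q)))

  ⊗-compl : ∀ p q → q ⊗ (𝟙 ⊖ p) ≋ q ⊖ q ⊗ p
  ⊗-compl p q = ≋-trans (⊗-distribˡ-⊕ q 𝟙 (neg p)) (≡⇒≋ (cong₂ _++_ (⊗-identityʳ q) (⊗-neg q p)))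

  star-++ : ∀ x y → star (x ++ y) ≡ star x ++ star y
  star-++ [] y = refl
  star-++ ((a , s) ∷ x) y = cong ((a , s ⋆) ∷_) (star-++ x y)

  star-involutive : ∀ x → star (star x) ≡ x
  star-involutive [] = refl
  star-involutive ((a , s) ∷ x) rewrite ⋆-invol s | star-involutive x = refl

  star-neg : ∀ x → star (neg x) ≡ neg (star x)
  star-neg [] = refl
  star-neg ((a , s) ∷ x) = cong ((- a , s ⋆) ∷_) (star-neg x)

  star-𝟙 : star 𝟙 ≡ 𝟙
  star-𝟙 rewrite ε⋆ = refl

  star-compl : ∀ p → star (𝟙 ⊖ p) ≡ 𝟙 ⊖ star p
  star-compl p = trans (star-++ 𝟙 (neg p)) (cong₂ _++_ star-𝟙 (star-neg p))

  star-cong : ∀ {x y} → x ≋ y → star x ≋ star y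
  star-cong ≋-refl = ≋-refl
  star-cong (≋-sym p) = ≋-sym (star-cong p)
  star-cong (≋-trans p q) = ≋-trans (star-cong p) (star-cong q)
  star-cong (≋-cons (a , s) p) = ≋-cons (a , s ⋆) (star-cong p)
  star-cong (≋-swap (a , s) (b , t) x) = ≋-swap _ _ (star x)
  star-cong (≋-merge a b s x) = ≋-merge a b (s ⋆) (star x)
  star-cong (≋-zeroc s x) = ≋-zeroc _ _
  star-cong (≋-zeroS a z x isZero) rewrite zero⋆ isZero = ≋-zeroS a z _ isZero

  scaleʳ : ℤ → A → Lin → Lin
  scaleʳ a s [] = []
  scaleʳ a s ((b , t) ∷ y) = (b *ℤ a , t · s) ∷ scaleʳ a s y

  ⊗-∷ʳ : ∀ y a s x → y ⊗ ((a , s) ∷ x) ≋ scaleʳ a s y ++ y ⊗ x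
  ⊗-∷ʳ [] a s x = ≋-refl
  ⊗-∷ʳ ((b , u) ∷ y) a s x rewrite ⊗-∷ b u y ((a , s) ∷ x) | ⊗-∷ b u y x =
    ≋-cons _ (≋-trans (++-congʳ (scale b u x) (⊗-∷ʳ y a s x))
                      (++-swap (scale b u x) (scaleʳ a s y) (y ⊗ x)))

  star-scale : ∀ a s y → star (scale a s y) ≡ scaleʳ a (s ⋆) (star y)
  star-scale a s [] = refl
  star-scale a s ((b , t) ∷ y) rewrite ℤ.*-comm a b | ⋆-anti s t | star-scale a s y = refl

  star-⊗ : ∀ x y → star (x ⊗ y) ≋ star y ⊗ star x
  star-⊗ [] y = ≡⇒≋ (sym (⊗-zeroʳ (star y)))
  star-⊗ ((a , s) ∷ x) y rewrite ⊗-∷ a s x y | star-++ (scale a s y) (x ⊗ y) | star-scale a s y =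
    ≋-trans (++-congʳ (scaleʳ a (s ⋆) (star y)) (star-⊗ x y))
            (≋-sym (⊗-∷ʳ (star y) a (s ⋆) (star x)))

  bar-𝟙 : bar 𝟙 ≋ 𝟘
  bar-𝟙 = ≋-trans (⊖-congʳ 𝟙 (≡⇒≋ (trans (⊗-identityˡ (star 𝟙)) star-𝟙))) (⊖-self 𝟙)

module Projections (S : InverseMonoid) where
  open InverseMonoid S renaming (Carrier to A)
  open InverseMonoidProperties S
  open ZAlg S
  open LinearCombinations S

  data Proj : Lin → Set where
    range  : ∀ s → Proj (ι (s · s ⋆))
    compl  : ∀ {p} → Proj p → Proj (𝟙 ⊖ p)
    meet   : ∀ {p q} → Proj p → Proj q → Proj (p ⊗ q)
    ≋-resp : ∀ {p q} → p ≋ q → Proj p → Proj q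

  Proj-𝟙 : Proj 𝟙
  Proj-𝟙 = ≋-resp (≡⇒≋ (cong ι (trans (identityˡ (ε ⋆)) ε⋆))) (range ε)

  Proj-range⋆ : ∀ s → Proj (ι (s ⋆ · s))
  Proj-range⋆ s = ≋-resp (≡⇒≋ (cong (λ w → ι (s ⋆ · w)) (⋆-invol s))) (range (s ⋆))

  Commute : Lin → Lin → Set
  Commute p q = p ⊗ q ≋ q ⊗ p

  commute-compl : ∀ p q → Commute p q → Commute (𝟙 ⊖ p) q
  commute-compl p q pq = begin
    (𝟙 ⊖ p) ⊗ q  ≈⟨ compl-⊗ p q ⟩
    q ⊖ p ⊗ q    ≈⟨ ⊖-congʳ q pq ⟩
    q ⊖ q ⊗ p    ≈⟨ ⊗-compl p q ⟨
    q ⊗ (𝟙 ⊖ p)  ∎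

  commute-⊗ : ∀ p q r → Commute p r → Commute q r → Commute (p ⊗ q) r
  commute-⊗ p q r pr qr = begin
    (p ⊗ q) ⊗ r  ≈⟨ ⊗-assoc p q r ⟩
    p ⊗ (q ⊗ r)  ≈⟨ ⊗-congʳ p qr ⟩
    p ⊗ (r ⊗ q)  ≈⟨ ⊗-assoc p r q ⟨
    (p ⊗ r) ⊗ q  ≈⟨ ⊗-congˡ q pr ⟩
    (r ⊗ p) ⊗ q  ≈⟨ ⊗-assoc r p q ⟩
    r ⊗ (p ⊗ q)  ∎

  commute-resp : ∀ p p′ q → p ≋ p′ → Commute p q → Commute p′ q
  commute-resp p p′ q e pq = ≋-trans (≋-trans (⊗-congˡ q (≋-sym e)) pq) (⊗-congʳ q e)

  range-commute : ∀ s {q} → Proj q → Commute (ι (s · s ⋆)) q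
  range-commute s (range t) = ≡⇒≋ (cong ι (idem-comm s t))
  range-commute s (compl {p} b) =
    ≋-sym (commute-compl p _ (≋-sym (range-commute s b)))
  range-commute s (meet {p} {q} b c) =
    ≋-sym (commute-⊗ p q _ (≋-sym (range-commute s b)) (≋-sym (range-commute s c)))
  range-commute s (≋-resp {p} {q} e b) =
    ≋-sym (commute-resp p q _ e (≋-sym (range-commute s b)))

  Proj-commute : ∀ {p q} → Proj p → Proj q → Commute p q
  Proj-commute (range s) b = range-commute s b
  Proj-commute {q = q} (compl {p} a) b = commute-compl p q (Proj-commute a b)
  Proj-commute {q = r} (meet {p} {q} a a′) b =
    commute-⊗ p q r (Proj-commute a b) (Proj-commute a′ b)
  Proj-commute {q = r} (≋-resp {p} {q} e a) b = commute-resp p q r e (Proj-commute a b)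

  Proj-idem : ∀ {p} → Proj p → p ⊗ p ≋ p
  Proj-idem (range s) = ≡⇒≋ (cong ι (ss⋆-idem s))
  Proj-idem (compl {p} a) = begin
    (𝟙 ⊖ p) ⊗ (𝟙 ⊖ p)      ≈⟨ compl-⊗ p (𝟙 ⊖ p) ⟩
    (𝟙 ⊖ p) ⊖ p ⊗ (𝟙 ⊖ p)  ≈⟨ ⊖-congʳ (𝟙 ⊖ p) (⊗-compl p p) ⟩
    (𝟙 ⊖ p) ⊖ (p ⊖ p ⊗ p)  ≈⟨ ⊖-congʳ (𝟙 ⊖ p) (⊖-congʳ p (Proj-idem a)) ⟩
    (𝟙 ⊖ p) ⊖ (p ⊖ p)      ≈⟨ ⊖-congʳ (𝟙 ⊖ p) (⊖-self p) ⟩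
    (𝟙 ⊖ p) ⊖ 𝟘            ≡⟨ ++-identityʳ (𝟙 ⊖ p) ⟩
    𝟙 ⊖ p                  ∎
  Proj-idem (meet {p} {q} a b) = begin
    (p ⊗ q) ⊗ (p ⊗ q)  ≈⟨ ⊗-assoc p q (p ⊗ q) ⟩
    p ⊗ (q ⊗ (p ⊗ q))  ≈⟨ ⊗-congʳ p (⊗-assoc q p q) ⟨
    p ⊗ ((q ⊗ p) ⊗ q)  ≈⟨ ⊗-congʳ p (⊗-congˡ q (Proj-commute b a)) ⟩
    p ⊗ ((p ⊗ q) ⊗ q)  ≈⟨ ⊗-congʳ p (⊗-assoc p q q) ⟩
    p ⊗ (p ⊗ (q ⊗ q))  ≈⟨ ⊗-assoc p p (q ⊗ q) ⟨
    (p ⊗ p) ⊗ (q ⊗ q)  ≈⟨ ⊗-cong (Proj-idem a) (Proj-idem b) ⟩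
    p ⊗ q              ∎
  Proj-idem (≋-resp e a) = ≋-trans (⊗-cong (≋-sym e) (≋-sym e)) (≋-trans (Proj-idem a) e)

  Proj-star : ∀ {p} → Proj p → star p ≋ p
  Proj-star (range s) = ≡⇒≋ (cong ι (ss⋆-⋆ s))
  Proj-star (compl {p} a) = ≋-trans (≡⇒≋ (star-compl p)) (⊖-congʳ 𝟙 (Proj-star a))
  Proj-star (meet {p} {q} a b) =
    ≋-trans (star-⊗ p q) (≋-trans (⊗-cong (Proj-star b) (Proj-star a)) (Proj-commute b a))
  Proj-star (≋-resp e a) = ≋-trans (star-cong (≋-sym e)) (≋-trans (Proj-star a) e)

  conj : A → Lin → Lin
  conj s p = ι s ⊗ p ⊗ ι (s ⋆)

  conj-cong : ∀ s {p q} → p ≋ q → conj s p ≋ conj s q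
  conj-cong s e = ⊗-congˡ (ι (s ⋆)) (⊗-congʳ (ι s) e)

  ι⊗-conj : ∀ s {p} → Proj p → ι s ⊗ p ≋ conj s p ⊗ ι s
  ι⊗-conj s {p} b = begin
    ι s ⊗ p                      ≡⟨ cong (λ w → ι w ⊗ p) (inverse′ s) ⟨
    (ι s ⊗ ι (s ⋆ · s)) ⊗ p      ≈⟨ ⊗-assoc (ι s) (ι (s ⋆ · s)) p ⟩
    ι s ⊗ (ι (s ⋆ · s) ⊗ p)      ≈⟨ ⊗-congʳ (ι s) (Proj-commute (Proj-range⋆ s) b) ⟩
    ι s ⊗ (p ⊗ ι (s ⋆ · s))      ≈⟨ ⊗-assoc (ι s) p (ι (s ⋆ · s)) ⟨
    (ι s ⊗ p) ⊗ (ι (s ⋆) ⊗ ι s)  ≈⟨ ⊗-assoc (ι s ⊗ p) (ι (s ⋆)) (ι s) ⟨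
    conj s p ⊗ ι s               ∎

  range⊗conj : ∀ s p → ι (s · s ⋆) ⊗ conj s p ≋ conj s p
  range⊗conj s p = begin
    e ⊗ ((ι s ⊗ p) ⊗ ι (s ⋆))  ≈⟨ ⊗-assoc e (ι s ⊗ p) (ι (s ⋆)) ⟨
    (e ⊗ (ι s ⊗ p)) ⊗ ι (s ⋆)  ≈⟨ ⊗-congˡ (ι (s ⋆)) (⊗-assoc e (ι s) p) ⟨
    ((e ⊗ ι s) ⊗ p) ⊗ ι (s ⋆)  ≡⟨ cong (λ w → (ι w ⊗ p) ⊗ ι (s ⋆)) (inverse s) ⟩
    conj s p                   ∎
    where e = ι (s · s ⋆)

  conj-compl : ∀ s p → conj s (𝟙 ⊖ p) ≋ ι (s · s ⋆) ⊗ (𝟙 ⊖ conj s p)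
  conj-compl s p = begin
    (ι s ⊗ (𝟙 ⊖ p)) ⊗ ι (s ⋆)  ≈⟨ ⊗-congˡ (ι (s ⋆)) (⊗-compl p (ι s)) ⟩
    (ι s ⊖ ι s ⊗ p) ⊗ ι (s ⋆)  ≡⟨ ⊗-distribʳ-⊕ (ι s) (neg (ι s ⊗ p)) (ι (s ⋆)) ⟩
    e ⊕ neg (ι s ⊗ p) ⊗ ι (s ⋆) ≡⟨ cong (e ⊕_) (neg-⊗ (ι s ⊗ p) (ι (s ⋆))) ⟩
    e ⊖ conj s p               ≈⟨ ⊖-congʳ e (range⊗conj s p) ⟨
    e ⊖ e ⊗ conj s p           ≈⟨ ⊗-compl (conj s p) e ⟨
    e ⊗ (𝟙 ⊖ conj s p)         ∎
    where e = ι (s · s ⋆)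

  conj-⊗ : ∀ s {p} q → Proj p → conj s (p ⊗ q) ≋ conj s p ⊗ conj s q
  conj-⊗ s {p} q a = begin
    (ι s ⊗ (p ⊗ q)) ⊗ ι (s ⋆)        ≈⟨ ⊗-congˡ (ι (s ⋆)) (⊗-assoc (ι s) p q) ⟨
    ((ι s ⊗ p) ⊗ q) ⊗ ι (s ⋆)        ≈⟨ ⊗-congˡ (ι (s ⋆)) (⊗-congˡ q (ι⊗-conj s a)) ⟩
    ((conj s p ⊗ ι s) ⊗ q) ⊗ ι (s ⋆) ≈⟨ ⊗-congˡ (ι (s ⋆)) (⊗-assoc (conj s p) (ι s) q) ⟩
    (conj s p ⊗ (ι s ⊗ q)) ⊗ ι (s ⋆) ≈⟨ ⊗-assoc (conj s p) (ι s ⊗ q) (ι (s ⋆)) ⟩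
    conj s p ⊗ conj s q              ∎

  conj-Proj : ∀ s {p} → Proj p → Proj (conj s p)
  conj-Proj s (range t) = ≋-resp (≡⇒≋ (cong ι (ss⋆-conj s t))) (range (s · t))
  conj-Proj s (compl {p} b) = ≋-resp (≋-sym (conj-compl s p)) (meet (range s) (compl (conj-Proj s b)))
  conj-Proj s (meet {p} {q} a b) = ≋-resp (≋-sym (conj-⊗ s q a)) (meet (conj-Proj s a) (conj-Proj s b))
  conj-Proj s (≋-resp e b) = ≋-resp (conj-cong s e) (conj-Proj s b)

  NormalForm : Lin → Set
  NormalForm u = ∃₂ λ p s → Proj p × u ≋ p ⊗ ι s

  NormalForm-ι : ∀ s → NormalForm (ι s)
  NormalForm-ι s = 𝟙 , s , Proj-𝟙 , ≡⇒≋ (sym (⊗-identityˡ (ι s)))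

  NormalForm-resp : ∀ {u v} → u ≋ v → NormalForm u → NormalForm v
  NormalForm-resp e (p , s , a , u≋ps) = p , s , a , ≋-trans (≋-sym e) u≋ps

  NormalForm-⊗ : ∀ {u v} → NormalForm u → NormalForm v → NormalForm (u ⊗ v)
  NormalForm-⊗ {u} {v} (p , s , a , u≋ps) (q , t , b , v≋qt) =
    p ⊗ conj s q , s · t , meet a (conj-Proj s b) , uv≋
    where
    uv≋ : u ⊗ v ≋ (p ⊗ conj s q) ⊗ ι (s · t)
    uv≋ = begin
      u ⊗ v                       ≈⟨ ⊗-cong u≋ps v≋qt ⟩
      (p ⊗ ι s) ⊗ (q ⊗ ι t)       ≈⟨ ⊗-assoc p (ι s) (q ⊗ ι t) ⟩
      p ⊗ (ι s ⊗ (q ⊗ ι t))       ≈⟨ ⊗-congʳ p (⊗-assoc (ι s) q (ι t)) ⟨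
      p ⊗ ((ι s ⊗ q) ⊗ ι t)       ≈⟨ ⊗-congʳ p (⊗-congˡ (ι t) (ι⊗-conj s b)) ⟩
      p ⊗ ((conj s q ⊗ ι s) ⊗ ι t) ≈⟨ ⊗-congʳ p (⊗-assoc (conj s q) (ι s) (ι t)) ⟩
      p ⊗ (conj s q ⊗ ι (s · t))  ≈⟨ ⊗-assoc p (conj s q) (ι (s · t)) ⟨
      (p ⊗ conj s q) ⊗ ι (s · t)  ∎

  star-normal : ∀ {u p s} → Proj p → u ≋ p ⊗ ι s → star u ≋ ι (s ⋆) ⊗ p
  star-normal {p = p} {s} a u≋ps =
    ≋-trans (star-cong u≋ps) (≋-trans (star-⊗ p (ι s)) (⊗-congʳ (ι (s ⋆)) (Proj-star a)))

  NormalForm-star : ∀ {u} → NormalForm u → NormalForm (star u)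
  NormalForm-star (p , s , a , u≋ps) =
    conj (s ⋆) p , s ⋆ , conj-Proj (s ⋆) a , ≋-trans (star-normal a u≋ps) (ι⊗-conj (s ⋆) a)

  ⊗star-normal : ∀ {u p s} → Proj p → u ≋ p ⊗ ι s → u ⊗ star u ≋ p ⊗ ι (s · s ⋆)
  ⊗star-normal {u} {p} {s} a u≋ps = begin
    u ⊗ star u                 ≈⟨ ⊗-cong u≋ps (star-normal a u≋ps) ⟩
    (p ⊗ ι s) ⊗ (ι (s ⋆) ⊗ p)  ≈⟨ ⊗-assoc p (ι s) (ι (s ⋆) ⊗ p) ⟩
    p ⊗ (ι s ⊗ (ι (s ⋆) ⊗ p))  ≈⟨ ⊗-congʳ p (⊗-assoc (ι s) (ι (s ⋆)) p) ⟨
    p ⊗ (ι (s · s ⋆) ⊗ p)      ≈⟨ ⊗-congʳ p (Proj-commute (range s) a) ⟩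
    p ⊗ (p ⊗ ι (s · s ⋆))      ≈⟨ ⊗-assoc p p (ι (s · s ⋆)) ⟨
    (p ⊗ p) ⊗ ι (s · s ⋆)      ≈⟨ ⊗-congˡ (ι (s · s ⋆)) (Proj-idem a) ⟩
    p ⊗ ι (s · s ⋆)            ∎

  NormalForm⇒Proj-⊗star : ∀ {u} → NormalForm u → Proj (u ⊗ star u)
  NormalForm⇒Proj-⊗star (p , s , a , u≋ps) = ≋-resp (≋-sym (⊗star-normal a u≋ps)) (meet a (range s))

  NormalForm⇒Proj-star⊗ : ∀ {u} → NormalForm u → Proj (star u ⊗ u)
  NormalForm⇒Proj-star⊗ {u} nf =
    ≋-resp (≡⇒≋ (cong (star u ⊗_) (star-involutive u))) (NormalForm⇒Proj-⊗star (NormalForm-star nf))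

  NormalForm-inverse : ∀ {u} → NormalForm u → u ⊗ star u ⊗ u ≋ u
  NormalForm-inverse {u} (p , s , a , u≋ps) = begin
    (u ⊗ star u) ⊗ u                ≈⟨ ⊗-cong (⊗star-normal a u≋ps) u≋ps ⟩
    (p ⊗ e) ⊗ (p ⊗ ι s)             ≈⟨ ⊗-assoc p e (p ⊗ ι s) ⟩
    p ⊗ (e ⊗ (p ⊗ ι s))             ≈⟨ ⊗-congʳ p (⊗-assoc e p (ι s)) ⟨
    p ⊗ ((e ⊗ p) ⊗ ι s)             ≈⟨ ⊗-congʳ p (⊗-congˡ (ι s) (Proj-commute (range s) a)) ⟩
    p ⊗ ((p ⊗ e) ⊗ ι s)             ≈⟨ ⊗-congʳ p (⊗-assoc p e (ι s)) ⟩
    p ⊗ (p ⊗ ι (s · s ⋆ · s))       ≡⟨ cong (λ w → p ⊗ (p ⊗ ι w)) (inverse s) ⟩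
    p ⊗ (p ⊗ ι s)                   ≈⟨ ⊗-assoc p p (ι s) ⟨
    (p ⊗ p) ⊗ ι s                   ≈⟨ ⊗-congˡ (ι s) (Proj-idem a) ⟩
    p ⊗ ι s                         ≈⟨ u≋ps ⟨
    u                               ∎
    where e = ι (s · s ⋆)

module Levels (S : InverseMonoid) where
  open InverseMonoid S using (ε; _⋆)
  open ZAlg S
  open LinearCombinations S
  open Projections S

  star-⊗star : ∀ u → star (u ⊗ star u) ≋ u ⊗ star u
  star-⊗star u = ≋-trans (star-⊗ u (star u)) (≡⇒≋ (cong (_⊗ star u) (star-involutive u)))

  Closure-star : ∀ {T} → (∀ {u} → T u → T (star u)) → ∀ {u} → Closure T u → Closure T (star u)
  Closure-star T-star (base t) = base (T-star t)
  Closure-star T-star (comp {u} t) =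
    resp (≋-sym (≋-trans (≡⇒≋ (star-compl (u ⊗ star u))) (⊖-congʳ 𝟙 (star-⊗star u)))) (comp t)
  Closure-star T-star one = resp (≡⇒≋ (sym star-𝟙)) one
  Closure-star T-star (mul {u} {v} c d) =
    resp (≋-sym (star-⊗ u v)) (mul (Closure-star T-star d) (Closure-star T-star c))
  Closure-star T-star (resp e c) = resp (star-cong e) (Closure-star T-star c)

  Closure-NormalForm : ∀ {T} → (∀ {u} → T u → NormalForm u) → ∀ {u} → Closure T u → NormalForm u
  Closure-NormalForm T-nf (base t) = T-nf t
  Closure-NormalForm T-nf (comp {u} t) =
    bar u , ε , compl (NormalForm⇒Proj-⊗star (T-nf t)) , ≡⇒≋ (sym (⊗-identityʳ (bar u)))
  Closure-NormalForm T-nf one = NormalForm-ι ε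
  Closure-NormalForm T-nf (mul c d) = NormalForm-⊗ (Closure-NormalForm T-nf c) (Closure-NormalForm T-nf d)
  Closure-NormalForm T-nf (resp e c) = NormalForm-resp e (Closure-NormalForm T-nf c)

  Level-resp : ∀ n {u v} → u ≋ v → Level n u → Level n v
  Level-resp zero e (s , u≋s) = s , ≋-trans (≋-sym e) u≋s
  Level-resp (suc n) e c = resp e c

  Level-mono : ∀ {m n u} → m ≤′ n → Level m u → Level n u
  Level-mono ≤′-refl l = l
  Level-mono (≤′-step m≤n) l = base (Level-mono m≤n l)

  Level-star : ∀ n {u} → Level n u → Level n (star u)
  Level-star zero (s , u≋s) = s ⋆ , star-cong u≋s
  Level-star (suc n) = Closure-star (Level-star n)

  Level-NormalForm : ∀ n {u} → Level n u → NormalForm u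
  Level-NormalForm zero (s , u≋s) = NormalForm-resp (≋-sym u≋s) (NormalForm-ι s)
  Level-NormalForm (suc n) = Closure-NormalForm (Level-NormalForm n)

  Ω-⊗ : ∀ {u v} → Ω u → Ω v → Ω (u ⊗ v)
  Ω-⊗ (m , l) (n , l′) =
    suc (m ⊔ n) , mul (base (Level-mono (≤⇒≤′ (m≤m⊔n m n)) l)) (base (Level-mono (≤⇒≤′ (m≤n⊔m m n)) l′))

  Ω-NormalForm : ∀ {u} → Ω u → NormalForm u
  Ω-NormalForm (n , l) = Level-NormalForm n l

  ⊗star-absorb : ∀ {u v} → NormalForm u → NormalForm v →
                 (u ⊗ v ⊗ star (u ⊗ v)) ⊗ u ≋ u ⊗ (v ⊗ star v)
  ⊗star-absorb {u} {v} nu nv = begin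
    ((u ⊗ v) ⊗ star (u ⊗ v)) ⊗ u       ≈⟨ ⊗-congˡ u (⊗-congʳ (u ⊗ v) (star-⊗ u v)) ⟩
    ((u ⊗ v) ⊗ (star v ⊗ star u)) ⊗ u  ≡⟨ trans (⊗-assoc-≡ (u ⊗ v) (star v ⊗ star u) u)
                                          (trans (⊗-assoc-≡ u v ((star v ⊗ star u) ⊗ u))
                                          (cong (λ w → u ⊗ (v ⊗ w)) (⊗-assoc-≡ (star v) (star u) u))) ⟩
    u ⊗ (v ⊗ (star v ⊗ (star u ⊗ u)))  ≈⟨ ⊗-congʳ u (⊗-assoc v (star v) (star u ⊗ u)) ⟨
    u ⊗ ((v ⊗ star v) ⊗ (star u ⊗ u))  ≈⟨ ⊗-congʳ u (Proj-commute (NormalForm⇒Proj-⊗star nv)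
                                                                  (NormalForm⇒Proj-star⊗ nu)) ⟩
    u ⊗ ((star u ⊗ u) ⊗ (v ⊗ star v))  ≡⟨ trans (sym (⊗-assoc-≡ u (star u ⊗ u) (v ⊗ star v)))
                                          (cong (_⊗ (v ⊗ star v)) (sym (⊗-assoc-≡ u (star u) u))) ⟩
    ((u ⊗ star u) ⊗ u) ⊗ (v ⊗ star v)  ≈⟨ ⊗-congˡ (v ⊗ star v) (NormalForm-inverse nu) ⟩
    u ⊗ (v ⊗ star v)                   ∎

  ⊗bar : ∀ {u v} → NormalForm u → NormalForm v → u ⊗ bar v ≋ bar (u ⊗ v) ⊗ u
  ⊗bar {u} {v} nu nv = begin
    u ⊗ (𝟙 ⊖ v ⊗ star v)                   ≈⟨ ⊗-compl (v ⊗ star v) u ⟩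
    u ⊖ u ⊗ (v ⊗ star v)                   ≈⟨ ⊖-congʳ u (⊗star-absorb nu nv) ⟨
    u ⊖ (u ⊗ v ⊗ star (u ⊗ v)) ⊗ u         ≈⟨ compl-⊗ (u ⊗ v ⊗ star (u ⊗ v)) u ⟨
    (𝟙 ⊖ u ⊗ v ⊗ star (u ⊗ v)) ⊗ u         ∎

  Ω-isBarInverseSubmonoid : IsBarInverseSubmonoid _≋_ _⊗_ 𝟙 star 𝟘 bar Ω
  Ω-isBarInverseSubmonoid = record
    { ≈-isEquivalence = ≋-isEquivalence
    ; P-resp    = λ { e (n , l) → n , Level-resp n e l }
    ; e∈        = 0 , ε , ≋-refl
    ; z∈        = 1 , resp bar-𝟙 (comp (ε , ≋-refl))
    ; ∙-closed  = Ω-⊗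
    ; ⋆-closed  = λ { (n , l) → n , Level-star n l }
    ; []-closed = λ { (n , l) → suc n , comp l }
    ; ∙-cong    = λ _ _ _ _ → ⊗-cong
    ; ⋆-cong    = λ _ _ → star-cong
    ; []-cong   = λ _ _ e → ⊖-congʳ 𝟙 (⊗-cong e (star-cong e))
    ; assoc     = λ {u} {v} {w} _ _ _ → ⊗-assoc u v w
    ; identityˡ = λ {u} _ → ≡⇒≋ (⊗-identityˡ u)
    ; identityʳ = λ {u} _ → ≡⇒≋ (⊗-identityʳ u)
    ; ⋆-anti    = λ {u} {v} _ _ → star-⊗ u v
    ; ⋆-invol   = λ {u} _ → ≡⇒≋ (star-involutive u)
    ; inverse   = λ Ωu → NormalForm-inverse (Ω-NormalForm Ωu)
    ; idem-comm = λ Ωu Ωv → Proj-commute (NormalForm⇒Proj-⊗star (Ω-NormalForm Ωu))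
                                         (NormalForm⇒Proj-⊗star (Ω-NormalForm Ωv))
    ; zeroˡ     = λ _ → ≋-refl
    ; zeroʳ     = λ {u} _ → ≡⇒≋ (⊗-zeroʳ u)
    ; bar-one   = bar-𝟙
    ; bar-zero  = ≋-refl
    ; bar-comm  = λ Ωu Ωv → ⊗bar (Ω-NormalForm Ωu) (Ω-NormalForm Ωv)
    }

mainTheorem2 : (S : InverseMonoid) →
    let open ZAlg S in
    IsBarInverseSubmonoid _≋_ _⊗_ 𝟙 star 𝟘 bar Ω
mainTheorem2 = Levels.Ω-isBarInverseSubmonoid
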